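{- Let $\mathsf{IntQCL}=\mathsf{G3IntQC}+\{(id^*_q),(\neg_l),(\neg_r),(\supset^*_l),(\forall^*_r),(\forall^*_l),(\exists^*_r),(lift)\}$ and let $\mathcal{H}=\mathsf{IntQCL}-\{(ref),(tra)\}$. Every labelled sequent derivable in $\mathcal{H}$ is derivable in $\mathcal{H}$ without any application of $(nd)$ or $(cd)$.
   Context: First-order formulas: $A::= p(x_1,\dots,x_n)\mid\bot\mid (A\vee A)\mid(A\wedge A)\mid(A\supset A)\mid \forall x A\mid\exists xA$ (0-ary predicates are propositional variables); $\neg A$ abbreviates $A\supset\bot$; bound variables are distinct from parameters $a,b,\dots$, which replace free variables. $A[a/x]$: substitution of $a$ for free $x$; $p(\vec{a})$ with $\vec{a}=a_0,\dots,a_n$ all its parameters; $\vec{a}\in D_w$ abbreviates $a_0\in D_w,\dots,a_n\in D_w$. Labelled sequents $\mathcal{R},\Gamma\Rightarrow\Delta$: $\mathcal{R}$ a multiset of relational atoms $w\le v$ and domain atoms $a\in D_w$, $\Gamma,\Delta$ multisets of labelled formulas $w:A$. $\mathsf{G3IntQC}$ rules: $(id_q)$: $\mathcal{R},w\le v,\vec{a}\in D_w,w:p(\vec{a}),\Gamma\Rightarrow\Delta,v:p(\vec{a})$ (its 0-ary case is $(id)$); $(\bot_l)$: $\mathcal{R},w:\bot,\Gamma\Rightarrow\Delta$; $(\wedge_l)$: from $\mathcal{R},w:A,w:B,\Gamma\Rightarrow\Delta$ infer $\mathcal{R},w:A\wedge B,\Gamma\Rightarrow\Delta$; $(\wedge_r)$: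 from $\mathcal{R},\Gamma\Rightarrow\Delta,w:A$ and $\mathcal{R},\Gamma\Rightarrow\Delta,w:B$ infer $\mathcal{R},\Gamma\Rightarrow\Delta,w:A\wedge B$; $(\vee_l)$: from $\mathcal{R},w:A,\Gamma\Rightarrow\Delta$ and $\mathcal{R},w:B,\Gamma\Rightarrow\Delta$ infer $\mathcal{R},w:A\vee B,\Gamma\Rightarrow\Delta$; $(\vee_r)$: from $\mathcal{R},\Gamma\Rightarrow\Delta,w:A,w:B$ infer $\mathcal{R},\Gamma\Rightarrow\Delta,w:A\vee B$; $(\supset_r)$: from $\mathcal{R},w\le v,v:A,\Gamma\Rightarrow\Delta,v:B$ infer $\mathcal{R},\Gamma\Rightarrow\Delta,w:A\supset B$, $v$ not in the conclusion; $(\supset_l)$: from $\mathcal{R},w\le v,w:A\supset B,\Gamma\Rightarrow\Delta,v:A$ and $\mathcal{R},w\le v,w:A\supset B,v:B,\Gamma\Rightarrow\Delta$ infer $\mathcal{R},w\le v,w:A\supset B,\Gamma\Rightarrow\Delta$; $(ref)$: from $\mathcal{R},w\le w,\Gamma\Rightarrow\Delta$ infer $\mathcal{R},\Gamma\Rightarrow\Delta$; $(tra)$: from $\mathcal{R},w\le v,v\le u,w\le u,\Gamma\Rightarrow\Delta$ infer $\mathcal{R},w\le v,v\le u,\Gamma\Rightarrow\Delta$; $(\forall_r)$: from $\mathcal{R},w\le v,a\in D_v,\Gamma\Rightarrow\Delta,v:A[a/x]$ infer $\mathcal{R},\Gamma\Rightarrow\Delta,w:\forall xA$, $a,v$ not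 in the conclusion; $(\exists_r)$: from $\mathcal{R},a\in D_w,\Gamma\Rightarrow\Delta,w:A[a/x],w:\exists xA$ infer $\mathcal{R},a\in D_w,\Gamma\Rightarrow\Delta,w:\exists xA$; $(\exists_l)$: from $\mathcal{R},a\in D_w,w:A[a/x],\Gamma\Rightarrow\Delta$ infer $\mathcal{R},w:\exists xA,\Gamma\Rightarrow\Delta$, $a$ not in the conclusion; $(\forall_l)$: from $\mathcal{R},w\le v,a\in D_v,v:A[a/x],w:\forall xA,\Gamma\Rightarrow\Delta$ infer $\mathcal{R},w\le v,a\in D_v,w:\forall xA,\Gamma\Rightarrow\Delta$; $(nd)$: from $\mathcal{R},w\le v,a\in D_w,a\in D_v,\Gamma\Rightarrow\Delta$ infer $\mathcal{R},w\le v,a\in D_w,\Gamma\Rightarrow\Delta$; $(cd)$: from $\mathcal{R},w\le v,a\in D_v,a\in D_w,\Gamma\Rightarrow\Delta$ infer $\mathcal{R},w\le v,a\in D_v,\Gamma\Rightarrow\Delta$. Additional rules: a (not necessarily directed) path from $v$ to $w$ in $\mathcal{R}$ exists iff $v=w$ or there are labels $v=z_0,\dots,z_k=w$ with $z_i\le z_{i+1}$ or $z_{i+1}\le z_i$ in $\mathcal{R}$ for each $i$. $(id^*_q)$: $\mathcal{R},a_0\in D_{v_0},\dots,a_n\in D_{v_n},w:p(\vec{a}),\Gamma\Rightarrow w:p(\vec{a}),\Delta$, $\vec{a}=a_0,\dots,a_n$, with a path from each $v_i$ to $w$ in $\mathcal{R}$; $(\neg_r)$: from $\mathcal{R},w\le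 v,v:A,\Gamma\Rightarrow\Delta$ infer $\mathcal{R},\Gamma\Rightarrow\Delta,w:\neg A$, $v$ not in the conclusion; $(\neg_l)$: from $\mathcal{R},w:\neg A,\Gamma\Rightarrow\Delta,w:A$ infer $\mathcal{R},w:\neg A,\Gamma\Rightarrow\Delta$; $(\supset^*_l)$: from $\mathcal{R},w:A\supset B,\Gamma\Rightarrow\Delta,w:A$ and $\mathcal{R},w:A\supset B,w:B,\Gamma\Rightarrow\Delta$ infer $\mathcal{R},w:A\supset B,\Gamma\Rightarrow\Delta$; $(\forall^*_r)$: from $\mathcal{R},a\in D_w,\Gamma\Rightarrow w:A[a/x],\Delta$ infer $\mathcal{R},\Gamma\Rightarrow w:\forall xA,\Delta$, $a$ not in the conclusion; $(\forall^*_l)$: from $\mathcal{R},a\in D_v,w:A[a/x],w:\forall xA,\Gamma\Rightarrow\Delta$ infer $\mathcal{R},a\in D_v,w:\forall xA,\Gamma\Rightarrow\Delta$, provided a path from $v$ to $w$ in $\mathcal{R}$; $(\exists^*_r)$: from $\mathcal{R},a\in D_v,\Gamma\Rightarrow\Delta,w:A[a/x],w:\exists xA$ infer $\mathcal{R},a\in D_v,\Gamma\Rightarrow\Delta,w:\exists xA$, provided a path from $v$ to $w$ in $\mathcal{R}$; $(lift)$: from $\mathcal{R},w\le u,w:A,u:A,\Gamma\Rightarrow\Delta$ infer $\mathcal{R},w\le u,w:A,\Gamma\Rightarrow\Delta$. -}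

module Defs where

open import Data.Nat using (ℕ; _≟_)
open import Data.Bool using (Bool; true; false)
open import Data.List using (List; []; _∷_; _++_; map; concatMap)
open import Data.List.Membership.Propositional using (_∈_; _∉_)
open import Data.List.Relation.Unary.All using (All)
open import Data.List.Relation.Binary.Permutation.Propositional using (_↭_)
open import Data.Product using (Σ; _×_; _,_)
open import Relation.Binary.PropositionalEquality using (_≡_)
open import Relation.Nullary using (yes; no)

Label : Set
Label = ℕ

Param : Set
Param = ℕ

Var : Set
Var = ℕ

data Term : Set where
  var : Var → Term
  par : Param → Term

infixr 6 _∧′_
infixr 5 _∨′_
infixr 4 _⊃_

data Fm : Set where
  atom : ℕ → List Term → Fm      -- p(t₁,…,tₙ); 0-ary = propositional variable
  ⊥′   : Fm
  _∨′_ : Fm → Fm → Fm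
  _∧′_ : Fm → Fm → Fm
  _⊃_  : Fm → Fm → Fm
  ∀′   : Var → Fm → Fm
  ∃′   : Var → Fm → Fm

¬′ : Fm → Fm
¬′ A = A ⊃ ⊥′

substT : Param → Var → Term → Term
substT a x (var y) with x ≟ y
... | yes _ = par a
... | no  _ = var y
substT a x (par b) = par b

_[_/_] : Fm → Param → Var → Fm
atom p ts [ a / x ] = atom p (map (substT a x) ts)
⊥′ [ a / x ] = ⊥′
(A ∨′ B) [ a / x ] = (A [ a / x ]) ∨′ (B [ a / x ])
(A ∧′ B) [ a / x ] = (A [ a / x ]) ∧′ (B [ a / x ])
(A ⊃ B) [ a / x ] = (A [ a / x ]) ⊃ (B [ a / x ])
∀′ y A [ a / x ] with x ≟ y
... | yes _ = ∀′ y A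
... | no  _ = ∀′ y (A [ a / x ])
∃′ y A [ a / x ] with x ≟ y
... | yes _ = ∃′ y A
... | no  _ = ∃′ y (A [ a / x ])

patom : ℕ → List Param → Fm
patom p as = atom p (map par as)

data RAtom : Set where
  _≼_  : Label → Label → RAtom
  _∈D_ : Param → Label → RAtom

LFm : Set
LFm = Label × Fm

-- multisets are represented by lists; the derivability relation below is
-- closed under permutation of each component (rule `exch`), so it only
-- depends on the underlying multisets.

paramsT : Term → List Param
paramsT (var _) = []
paramsT (par a) = a ∷ []

paramsF : Fm → List Param
paramsF (atom _ ts) = concatMap paramsT ts
paramsF ⊥′ = []
paramsF (A ∨′ B) = paramsF A ++ paramsF B
paramsF (A ∧′ B) = paramsF A ++ paramsF B
paramsF (A ⊃ B) = paramsF A ++ paramsF B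
paramsF (∀′ _ A) = paramsF A
paramsF (∃′ _ A) = paramsF A

paramsR : RAtom → List Param
paramsR (_ ≼ _) = []
paramsR (a ∈D _) = a ∷ []

labelsR : RAtom → List Label
labelsR (w ≼ v) = w ∷ v ∷ []
labelsR (_ ∈D w) = w ∷ []

labelsL : LFm → List Label
labelsL (w , _) = w ∷ []

paramsL : LFm → List Param
paramsL (_ , A) = paramsF A

labelsS : List RAtom → List LFm → List LFm → List Label
labelsS R Γ Δ = concatMap labelsR R ++ concatMap labelsL Γ ++ concatMap labelsL Δ

paramsS : List RAtom → List LFm → List LFm → List Param
paramsS R Γ Δ = concatMap paramsR R ++ concatMap paramsL Γ ++ concatMap paramsL Δ

data Path (R : List RAtom) : Label → Label → Set where
  here : ∀ {v} → Path R v v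
  fwd  : ∀ {v z w} → (v ≼ z) ∈ R → Path R z w → Path R v w
  bwd  : ∀ {v z w} → (z ≼ v) ∈ R → Path R z w → Path R v w

-- The calculus H = IntQCL − {(ref),(tra)}, i.e.
--   G3IntQC − {(ref),(tra)} + {(id*q),(¬l),(¬r),(⊃*l),(∀*r),(∀*l),(∃*r),(lift)}.
-- `DerH nd? R Γ Δ` : the sequent R, Γ ⇒ Δ is derivable in H; when
-- nd? = false the rules (nd) and (cd) may not be used.

data DerH (ndcd : Bool) : List RAtom → List LFm → List LFm → Set where
  exch : ∀ {R R′ Γ Γ′ Δ Δ′} → R ↭ R′ → Γ ↭ Γ′ → Δ ↭ Δ′ →
         DerH ndcd R Γ Δ → DerH ndcd R′ Γ′ Δ′
  idq : ∀ {R Γ Δ w v p as} → (w ≼ v) ∈ R → All (λ a → (a ∈D w) ∈ R) as →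
        (w , patom p as) ∈ Γ → (v , patom p as) ∈ Δ → DerH ndcd R Γ Δ
  idq* : ∀ {R Γ Δ w p as} →
         All (λ a → Σ Label (λ v → (a ∈D v) ∈ R × Path R v w)) as →
         (w , patom p as) ∈ Γ → (w , patom p as) ∈ Δ → DerH ndcd R Γ Δ
  ⊥l : ∀ {R Γ Δ w} → (w , ⊥′) ∈ Γ → DerH ndcd R Γ Δ
  ∧l : ∀ {R Γ Δ w A B} → DerH ndcd R ((w , A) ∷ (w , B) ∷ Γ) Δ →
       DerH ndcd R ((w , A ∧′ B) ∷ Γ) Δ
  ∧r : ∀ {R Γ Δ w A B} → DerH ndcd R Γ ((w , A) ∷ Δ) → DerH ndcd R Γ ((w , B) ∷ Δ) →
       DerH ndcd R Γ ((w , A ∧′ B) ∷ Δ)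
  ∨l : ∀ {R Γ Δ w A B} → DerH ndcd R ((w , A) ∷ Γ) Δ → DerH ndcd R ((w , B) ∷ Γ) Δ →
       DerH ndcd R ((w , A ∨′ B) ∷ Γ) Δ
  ∨r : ∀ {R Γ Δ w A B} → DerH ndcd R Γ ((w , A) ∷ (w , B) ∷ Δ) →
       DerH ndcd R Γ ((w , A ∨′ B) ∷ Δ)
  ⊃r : ∀ {R Γ Δ w v A B} → v ∉ labelsS R Γ ((w , A ⊃ B) ∷ Δ) →
       DerH ndcd ((w ≼ v) ∷ R) ((v , A) ∷ Γ) ((v , B) ∷ Δ) →
       DerH ndcd R Γ ((w , A ⊃ B) ∷ Δ)
  ⊃l : ∀ {R Γ Δ w v A B} →
       DerH ndcd ((w ≼ v) ∷ R) ((w , A ⊃ B) ∷ Γ) ((v , A) ∷ Δ) →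
       DerH ndcd ((w ≼ v) ∷ R) ((v , B) ∷ (w , A ⊃ B) ∷ Γ) Δ →
       DerH ndcd ((w ≼ v) ∷ R) ((w , A ⊃ B) ∷ Γ) Δ
  ∀r : ∀ {R Γ Δ w v a x A} →
       v ∉ labelsS R Γ ((w , ∀′ x A) ∷ Δ) → a ∉ paramsS R Γ ((w , ∀′ x A) ∷ Δ) →
       DerH ndcd ((w ≼ v) ∷ (a ∈D v) ∷ R) Γ ((v , A [ a / x ]) ∷ Δ) →
       DerH ndcd R Γ ((w , ∀′ x A) ∷ Δ)
  ∃r : ∀ {R Γ Δ w a x A} →
       DerH ndcd ((a ∈D w) ∷ R) Γ ((w , A [ a / x ]) ∷ (w , ∃′ x A) ∷ Δ) →
       DerH ndcd ((a ∈D w) ∷ R) Γ ((w , ∃′ x A) ∷ Δ)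
  ∃l : ∀ {R Γ Δ w a x A} → a ∉ paramsS R ((w , ∃′ x A) ∷ Γ) Δ →
       DerH ndcd ((a ∈D w) ∷ R) ((w , A [ a / x ]) ∷ Γ) Δ →
       DerH ndcd R ((w , ∃′ x A) ∷ Γ) Δ
  ∀l : ∀ {R Γ Δ w v a x A} →
       DerH ndcd ((w ≼ v) ∷ (a ∈D v) ∷ R) ((v , A [ a / x ]) ∷ (w , ∀′ x A) ∷ Γ) Δ →
       DerH ndcd ((w ≼ v) ∷ (a ∈D v) ∷ R) ((w , ∀′ x A) ∷ Γ) Δ
  nd : ∀ {R Γ Δ w v a} → ndcd ≡ true →
       DerH ndcd ((w ≼ v) ∷ (a ∈D w) ∷ (a ∈D v) ∷ R) Γ Δ →
       DerH ndcd ((w ≼ v) ∷ (a ∈D w) ∷ R) Γ Δ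
  cd : ∀ {R Γ Δ w v a} → ndcd ≡ true →
       DerH ndcd ((w ≼ v) ∷ (a ∈D v) ∷ (a ∈D w) ∷ R) Γ Δ →
       DerH ndcd ((w ≼ v) ∷ (a ∈D v) ∷ R) Γ Δ
  ¬r : ∀ {R Γ Δ w v A} → v ∉ labelsS R Γ ((w , ¬′ A) ∷ Δ) →
       DerH ndcd ((w ≼ v) ∷ R) ((v , A) ∷ Γ) Δ →
       DerH ndcd R Γ ((w , ¬′ A) ∷ Δ)
  ¬l : ∀ {R Γ Δ w A} → DerH ndcd R ((w , ¬′ A) ∷ Γ) ((w , A) ∷ Δ) →
       DerH ndcd R ((w , ¬′ A) ∷ Γ) Δ
  ⊃l* : ∀ {R Γ Δ w A B} →
        DerH ndcd R ((w , A ⊃ B) ∷ Γ) ((w , A) ∷ Δ) →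
        DerH ndcd R ((w , B) ∷ (w , A ⊃ B) ∷ Γ) Δ →
        DerH ndcd R ((w , A ⊃ B) ∷ Γ) Δ
  ∀r* : ∀ {R Γ Δ w a x A} → a ∉ paramsS R Γ ((w , ∀′ x A) ∷ Δ) →
        DerH ndcd ((a ∈D w) ∷ R) Γ ((w , A [ a / x ]) ∷ Δ) →
        DerH ndcd R Γ ((w , ∀′ x A) ∷ Δ)
  ∀l* : ∀ {R Γ Δ w v a x A} → Path ((a ∈D v) ∷ R) v w →
        DerH ndcd ((a ∈D v) ∷ R) ((w , A [ a / x ]) ∷ (w , ∀′ x A) ∷ Γ) Δ →
        DerH ndcd ((a ∈D v) ∷ R) ((w , ∀′ x A) ∷ Γ) Δ
  ∃r* : ∀ {R Γ Δ w v a x A} → Path ((a ∈D v) ∷ R) v w →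
        DerH ndcd ((a ∈D v) ∷ R) Γ ((w , A [ a / x ]) ∷ (w , ∃′ x A) ∷ Δ) →
        DerH ndcd ((a ∈D v) ∷ R) Γ ((w , ∃′ x A) ∷ Δ)
  lift : ∀ {R Γ Δ w u A} →
         DerH ndcd ((w ≼ u) ∷ R) ((u , A) ∷ (w , A) ∷ Γ) Δ →
         DerH ndcd ((w ≼ u) ∷ R) ((w , A) ∷ Γ) Δ

-- A derivation is translated bottom-up, replacing its relational part R by a
-- reduct R′ ⊆ R that keeps every atom w ≤ v of R but only needs to witness each
-- domain atom a ∈ D_v of R by some a ∈ D_u of R′ with a path from u to v.
-- (nd) and (cd) add a domain atom joined by a one-step path to an existing one,
-- so they preserve this invariant and can simply be dropped.  The rules that
-- need a ∈ D_v literally become their path-tolerant variants: (∃r) becomes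
-- (∃*r), (id_q) becomes (lift) then (id*_q), and (∀l) becomes (lift) of w : ∀xA
-- to v then (∀*l).  The copies v : ∀xA so lifted accumulate as extra antecedent
-- formulas; their labels already occur in R′ and their formulas in Γ, so they
-- never violate an eigenvariable condition.

module Submission where

open import Defs
open import Data.Bool using (Bool; true; false)
open import Data.List using (List; []; _∷_; _++_; concatMap)
open import Data.List.Properties using (++-identityʳ)
open import Data.List.Membership.Propositional using (_∈_; _∉_; find; lose)
open import Data.List.Membership.Propositional.Properties
  using (∈-++⁺ˡ; ∈-++⁺ʳ; ∈-++⁻; ∈-∃++; ∈-concatMap⁺; ∈-concatMap⁻)
open import Data.List.Relation.Binary.Subset.Propositional using (_⊆_)
open import Data.List.Relation.Binary.Subset.Propositional.Properties using (⊆-refl; concatMap⁺)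
open import Data.List.Relation.Unary.Any using (here; there)
import Data.List.Relation.Unary.Any.Properties as Any
open import Data.List.Relation.Unary.All as All using (All; []; _∷_)
open import Data.List.Relation.Binary.Permutation.Propositional using (_↭_; ↭-refl; ↭-sym; ↭-reflexive; prep)
open import Data.List.Relation.Binary.Permutation.Propositional.Properties using (∈-resp-↭; ++⁺ʳ; shift)
open import Data.Product using (Σ; _×_; _,_)
open import Data.Sum using (inj₁; inj₂)
open import Function using (_∘_)
open import Relation.Binary.PropositionalEquality using (_≢_; refl)

private
  variable
    X : Set
    R R′ R₁ R₂ Γ Γ₁ Γ₂ Δ Ex : List _
    u v w : Label
    a : Param
    x : Var
    A B : Fm

∈⇒↭∷ : ∀ {y : X} {xs} → y ∈ xs → Σ (List X) λ ys → xs ↭ y ∷ ys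
∈⇒↭∷ {y = y} y∈xs with ys , zs , refl ← ∈-∃++ y∈xs = ys ++ zs , shift y ys zs

Path-map : (∀ {w v} → (w ≼ v) ∈ R₁ → (w ≼ v) ∈ R₂) → Path R₁ u v → Path R₂ u v
Path-map f here      = here
Path-map f (fwd m p) = fwd (f m) (Path-map f p)
Path-map f (bwd m p) = bwd (f m) (Path-map f p)

Path-trans : Path R u v → Path R v w → Path R u w
Path-trans here      q = q
Path-trans (fwd m p) q = fwd m (Path-trans p q)
Path-trans (bwd m p) q = bwd m (Path-trans p q)

module _ (f : RAtom → List X) (g : LFm → List X) where

  occurrences-++-⊆ : ∀ {R′ R Γ Ex D} → R′ ⊆ R →
                     (∀ {e} → e ∈ Ex → g e ⊆ concatMap f R′ ++ concatMap g Γ) →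
                     concatMap f R′ ++ concatMap g (Γ ++ Ex) ++ concatMap g D ⊆
                     concatMap f R ++ concatMap g Γ ++ concatMap g D
  occurrences-++-⊆ {R′ = R′} {R = R} {Γ = Γ} R′⊆R Ex⊆ y∈ with ∈-++⁻ (concatMap f R′) y∈
  ... | inj₁ y∈R′ = ∈-++⁺ˡ (concatMap⁺ f R′⊆R y∈R′)
  ... | inj₂ y∈ΓExD with ∈-++⁻ (concatMap g (Γ ++ _)) y∈ΓExD
  ... | inj₂ y∈D = ∈-++⁺ʳ (concatMap f R) (∈-++⁺ʳ (concatMap g Γ) y∈D)
  ... | inj₁ y∈ΓEx with Any.++⁻ Γ (∈-concatMap⁻ g y∈ΓEx)
  ... | inj₁ y∈Γ = ∈-++⁺ʳ (concatMap f R) (∈-++⁺ˡ (∈-concatMap⁺ g y∈Γ))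
  ... | inj₂ y∈Ex with _ , e∈Ex , y∈e ← find y∈Ex with ∈-++⁻ (concatMap f R′) (Ex⊆ e∈Ex y∈e)
  ... | inj₁ y∈R′ = ∈-++⁺ˡ (concatMap⁺ f R′⊆R y∈R′)
  ... | inj₂ y∈Γ  = ∈-++⁺ʳ (concatMap f R) (∈-++⁺ˡ y∈Γ)

record Reduct (R′ R : List RAtom) : Set where
  field
    ⊆-reduct  : R′ ⊆ R
    ≼-reduct  : ∀ {w v} → (w ≼ v) ∈ R → (w ≼ v) ∈ R′
    ∈D-reduct : ∀ {a v} → (a ∈D v) ∈ R → Σ Label λ u → (a ∈D u) ∈ R′ × Path R′ u v
open Reduct

Reduct-refl : Reduct R R
Reduct-refl = record { ⊆-reduct = ⊆-refl ; ≼-reduct = λ m → m ; ∈D-reduct = λ m → _ , m , here }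

Reduct-∷ : ∀ {r} → Reduct R′ R → Reduct (r ∷ R′) (r ∷ R)
Reduct-∷ {R′ = R′} {R = R} {r = r} s =
  record { ⊆-reduct = sub ; ≼-reduct = rel ; ∈D-reduct = dom }
  where
  sub : r ∷ R′ ⊆ r ∷ R
  sub (here e)  = here e
  sub (there m) = there (⊆-reduct s m)
  rel : (w ≼ v) ∈ r ∷ R → (w ≼ v) ∈ r ∷ R′
  rel (here e)  = here e
  rel (there m) = there (≼-reduct s m)
  dom : (a ∈D v) ∈ r ∷ R → Σ Label λ u → (a ∈D u) ∈ r ∷ R′ × Path (r ∷ R′) u v
  dom (here refl) = _ , here refl , here
  dom (there m) with u , a∈Du , path ← ∈D-reduct s m = u , there a∈Du , Path-map there path

Reduct-resp-↭ : R₁ ↭ R₂ → Reduct R′ R₂ → Reduct R′ R₁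
Reduct-resp-↭ p s = record
  { ⊆-reduct  = ∈-resp-↭ (↭-sym p) ∘ ⊆-reduct s
  ; ≼-reduct  = ≼-reduct s ∘ ∈-resp-↭ p
  ; ∈D-reduct = ∈D-reduct s ∘ ∈-resp-↭ p
  }

∈D-reduct-Path : Reduct R′ R → (a ∈D v) ∈ R → Path R v w → Σ Label λ u → (a ∈D u) ∈ R′ × Path R′ u w
∈D-reduct-Path s a∈Dv path with u , a∈Du , path′ ← ∈D-reduct s a∈Dv =
  u , a∈Du , Path-trans path′ (Path-map (≼-reduct s) path)

Reduct-∈D-Path : Reduct R′ R → (a ∈D v) ∈ R → Path R v w → Reduct R′ ((a ∈D w) ∷ R)
Reduct-∈D-Path s a∈Dv path = record
  { ⊆-reduct  = there ∘ ⊆-reduct s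
  ; ≼-reduct  = λ { (there m) → ≼-reduct s m }
  ; ∈D-reduct = λ { (here refl) → ∈D-reduct-Path s a∈Dv path ; (there m) → ∈D-reduct s m }
  }

≼-target-label : (w ≼ v) ∈ R → v ∈ concatMap labelsR R
≼-target-label wv∈R = ∈-concatMap⁺ labelsR (lose wv∈R (there (here refl)))

data LiftedForall (R : List RAtom) (Γ : List LFm) : LFm → Set where
  lifted : v ∈ concatMap labelsR R → (w , ∀′ x A) ∈ Γ → LiftedForall R Γ (v , ∀′ x A)

LiftedForalls : List RAtom → List LFm → List LFm → Set
LiftedForalls R Γ = All (LiftedForall R Γ)

LiftedForalls-mono : R₁ ⊆ R₂ → Γ₁ ⊆ Γ₂ → LiftedForalls R₁ Γ₁ Ex → LiftedForalls R₂ Γ₂ Ex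
LiftedForalls-mono R₁⊆R₂ Γ₁⊆Γ₂ = All.map λ { (lifted v∈R m) → lifted (concatMap⁺ labelsR R₁⊆R₂ v∈R) (Γ₁⊆Γ₂ m) }

LiftedForalls-drop : (∀ {x A} → B ≢ ∀′ x A) → LiftedForalls R ((w , B) ∷ Γ) Ex → LiftedForalls R Γ Ex
LiftedForalls-drop {B = B} {R = R} {w = w} {Γ = Γ} B≢∀ = All.map drop
  where
  drop : ∀ {e} → LiftedForall R ((w , B) ∷ Γ) e → LiftedForall R Γ e
  drop (lifted v∈R (here refl)) with () ← B≢∀ refl
  drop (lifted v∈R (there m))   = lifted v∈R m

fresh-label : ∀ {D} → Reduct R′ R → LiftedForalls R′ Γ Ex → v ∉ labelsS R Γ D → v ∉ labelsS R′ (Γ ++ Ex) D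
fresh-label {R′ = R′} {Γ = Γ} {Ex = Ex} {D = D} s ex v∉ =
  v∉ ∘ occurrences-++-⊆ labelsR labelsL {Γ = Γ} {Ex = Ex} {D = D} (⊆-reduct s) (labels⊆ ∘ All.lookup ex)
  where
  labels⊆ : ∀ {e} → LiftedForall R′ Γ e → labelsL e ⊆ concatMap labelsR R′ ++ concatMap labelsL Γ
  labels⊆ (lifted v∈R _) (here refl) = ∈-++⁺ˡ v∈R

fresh-param : ∀ {D} → Reduct R′ R → LiftedForalls R′ Γ Ex → a ∉ paramsS R Γ D → a ∉ paramsS R′ (Γ ++ Ex) D
fresh-param {R′ = R′} {Γ = Γ} {Ex = Ex} {D = D} s ex a∉ =
  a∉ ∘ occurrences-++-⊆ paramsR paramsL {Γ = Γ} {Ex = Ex} {D = D} (⊆-reduct s) (params⊆ ∘ All.lookup ex)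
  where
  params⊆ : ∀ {e} → LiftedForall R′ Γ e → paramsL e ⊆ concatMap paramsR R′ ++ concatMap paramsL Γ
  params⊆ (lifted _ m) y∈A = ∈-++⁺ʳ (concatMap paramsR R′) (∈-concatMap⁺ paramsL (lose m y∈A))

module _ {b : Bool} {R : List RAtom} {Γ Δ : List LFm} where

  lift-∈ : (w ≼ u) ∈ R → (w , A) ∈ Γ → DerH b R ((u , A) ∷ Γ) Δ → DerH b R Γ Δ
  lift-∈ wu∈R wA∈Γ d with _ , R↭ ← ∈⇒↭∷ wu∈R | _ , Γ↭ ← ∈⇒↭∷ wA∈Γ =
    exch (↭-sym R↭) (↭-sym Γ↭) ↭-refl (lift (exch R↭ (prep _ Γ↭) ↭-refl d))

  ⊃l-∈ : (w ≼ v) ∈ R → DerH b R ((w , A ⊃ B) ∷ Γ) ((v , A) ∷ Δ) →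
         DerH b R ((v , B) ∷ (w , A ⊃ B) ∷ Γ) Δ → DerH b R ((w , A ⊃ B) ∷ Γ) Δ
  ⊃l-∈ wv∈R d₁ d₂ with _ , R↭ ← ∈⇒↭∷ wv∈R =
    exch (↭-sym R↭) ↭-refl ↭-refl (⊃l (exch R↭ ↭-refl ↭-refl d₁) (exch R↭ ↭-refl ↭-refl d₂))

  ∀l*-∈ : (a ∈D u) ∈ R → Path R u w →
          DerH b R ((w , A [ a / x ]) ∷ (w , ∀′ x A) ∷ Γ) Δ → DerH b R ((w , ∀′ x A) ∷ Γ) Δ
  ∀l*-∈ a∈Du path d with _ , R↭ ← ∈⇒↭∷ a∈Du =
    exch (↭-sym R↭) ↭-refl ↭-refl (∀l* (Path-map (∈-resp-↭ R↭) path) (exch R↭ ↭-refl ↭-refl d))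

  ∃r*-∈ : (a ∈D u) ∈ R → Path R u w →
          DerH b R Γ ((w , A [ a / x ]) ∷ (w , ∃′ x A) ∷ Δ) → DerH b R Γ ((w , ∃′ x A) ∷ Δ)
  ∃r*-∈ a∈Du path d with _ , R↭ ← ∈⇒↭∷ a∈Du =
    exch (↭-sym R↭) ↭-refl ↭-refl (∃r* (Path-map (∈-resp-↭ R↭) path) (exch R↭ ↭-refl ↭-refl d))

translate : DerH true R Γ Δ → Reduct R′ R → LiftedForalls R′ Γ Ex → DerH false R′ (Γ ++ Ex) Δ
translate {Ex = Ex} (exch R↭ Γ↭ Δ↭ d) s ex =
  exch ↭-refl (++⁺ʳ Ex Γ↭) Δ↭
    (translate d (Reduct-resp-↭ R↭ s) (LiftedForalls-mono ⊆-refl (∈-resp-↭ (↭-sym Γ↭)) ex))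
translate (idq wv∈R as∈Dw wp∈Γ vp∈Δ) s ex =
  lift-∈ (≼-reduct s wv∈R) (∈-++⁺ˡ wp∈Γ)
    (idq* (All.map (λ a∈Dw → ∈D-reduct-Path s a∈Dw (fwd wv∈R here)) as∈Dw) (here refl) vp∈Δ)
translate (idq* as∈D wp∈Γ wp∈Δ) s ex =
  idq* (All.map (λ { (_ , a∈D , path) → ∈D-reduct-Path s a∈D path }) as∈D) (∈-++⁺ˡ wp∈Γ) wp∈Δ
translate (⊥l w⊥∈Γ) s ex = ⊥l (∈-++⁺ˡ w⊥∈Γ)
translate (∧l d) s ex =
  ∧l (translate d s (LiftedForalls-mono ⊆-refl (there ∘ there) (LiftedForalls-drop (λ ()) ex)))
translate (∧r d₁ d₂) s ex = ∧r (translate d₁ s ex) (translate d₂ s ex)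
translate (∨l d₁ d₂) s ex =
  ∨l (translate d₁ s (LiftedForalls-mono ⊆-refl there (LiftedForalls-drop (λ ()) ex)))
     (translate d₂ s (LiftedForalls-mono ⊆-refl there (LiftedForalls-drop (λ ()) ex)))
translate (∨r d) s ex = ∨r (translate d s ex)
translate {Δ = Δ} (⊃r v-fresh d) s ex =
  ⊃r (fresh-label {D = Δ} s ex v-fresh) (translate d (Reduct-∷ s) (LiftedForalls-mono there there ex))
translate (⊃l d₁ d₂) s ex =
  ⊃l-∈ (≼-reduct s (here refl)) (translate d₁ s ex) (translate d₂ s (LiftedForalls-mono ⊆-refl there ex))
translate {Δ = Δ} (∀r v-fresh a-fresh d) s ex =
  ∀r (fresh-label {D = Δ} s ex v-fresh) (fresh-param {D = Δ} s ex a-fresh)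
     (translate d (Reduct-∷ (Reduct-∷ s)) (LiftedForalls-mono (there ∘ there) ⊆-refl ex))
translate (∃r d) s ex with _ , a∈Du , path ← ∈D-reduct s (here refl) =
  ∃r*-∈ a∈Du path (translate d s ex)
translate {Δ = Δ} (∃l a-fresh d) s ex =
  ∃l (fresh-param {D = Δ} s ex a-fresh)
     (translate d (Reduct-∷ s) (LiftedForalls-mono there there (LiftedForalls-drop (λ ()) ex)))
translate {R′ = R′} {Ex = Ex} (∀l {Γ = Γ} {w = w} {v = v} {x = x} {A = A} d) s ex
  with _ , a∈Du , path ← ∈D-reduct s (there (here refl)) =
  lift-∈ wv∈R′ (here refl) (∀l*-∈ a∈Du path
    (exch ↭-refl (prep _ (shift (v , ∀′ x A) ((w , ∀′ x A) ∷ Γ) Ex)) ↭-refl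
      (translate d s (lifted (≼-target-label wv∈R′) (there (here refl)) ∷ LiftedForalls-mono ⊆-refl there ex))))
  where
  wv∈R′ : (w ≼ v) ∈ R′
  wv∈R′ = ≼-reduct s (here refl)
translate (nd _ d) s ex =
  translate d (Reduct-resp-↭ (shift _ (_ ∷ _ ∷ []) _)
                 (Reduct-∈D-Path s (there (here refl)) (fwd (here refl) here))) ex
translate (cd _ d) s ex =
  translate d (Reduct-resp-↭ (shift _ (_ ∷ _ ∷ []) _)
                 (Reduct-∈D-Path s (there (here refl)) (bwd (here refl) here))) ex
translate {Δ = Δ} (¬r v-fresh d) s ex =
  ¬r (fresh-label {D = Δ} s ex v-fresh) (translate d (Reduct-∷ s) (LiftedForalls-mono there there ex))
translate (¬l d) s ex = ¬l (translate d s ex)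
translate (⊃l* d₁ d₂) s ex =
  ⊃l* (translate d₁ s ex) (translate d₂ s (LiftedForalls-mono ⊆-refl there ex))
translate {Δ = Δ} (∀r* a-fresh d) s ex =
  ∀r* (fresh-param {D = Δ} s ex a-fresh) (translate d (Reduct-∷ s) (LiftedForalls-mono there ⊆-refl ex))
translate (∀l* path d) s ex with _ , a∈Du , path′ ← ∈D-reduct-Path s (here refl) path =
  ∀l*-∈ a∈Du path′ (translate d s (LiftedForalls-mono ⊆-refl there ex))
translate (∃r* path d) s ex with _ , a∈Du , path′ ← ∈D-reduct-Path s (here refl) path =
  ∃r*-∈ a∈Du path′ (translate d s ex)
translate (lift d) s ex =
  lift-∈ (≼-reduct s (here refl)) (here refl) (translate d s (LiftedForalls-mono ⊆-refl there ex))

lemma8 : (R : List RAtom) (Γ Δ : List LFm) → DerH true R Γ Δ → DerH false R Γ Δ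
lemma8 R Γ Δ d = exch ↭-refl (↭-reflexive (++-identityʳ Γ)) ↭-refl (translate d Reduct-refl [])
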